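{- Let $X$ and $Y$ be generalized ordered sets. Then the cartesian product $X\times Y$, equipped with the lexicographic order, is a generalized ordered set.
   Context: The setting is constructive mathematics: no use of the law of excluded middle. For a set $X$ with a binary relation $<$, write $x\leq_{P}y$ if for all $z\in X$, $z<x$ implies $z<y$, and $y<z$ implies $x<z$. A generalized ordered set is a set $X$ with a binary relation $<$ such that for all $x,y,z\in X$: (asymmetry) $x<y$ implies $\neg(y<x)$; (transitivity) $x<y$ and $y<z$ imply $x<z$; (positive antisymmetry) $x\leq_{P}y$ and $y\leq_{P}x$ imply $x=y$. The cartesian product $X\times Y$ has equality $(x,y)=(x',y')$ iff $x=x'$ and $y=y'$. The lexicographic order is $(x,y)<(x',y')$ iff $x<x'$, or ($x=x'$ and $y<y'$). -}

module Defs where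

open import Level using (Level; _⊔_; suc)
open import Data.Product using (_×_; _,_)
open import Data.Sum using (_⊎_)
open import Relation.Nullary using (¬_)
open import Relation.Binary.Core using (Rel)
open import Relation.Binary.Bundles using (Setoid)
open import Relation.Binary.Definitions using (_Respects₂_)
open import Data.Product.Relation.Binary.Pointwise.NonDependent using (×-setoid)

-- A "set" in the constructive (Bishop) sense: a setoid.
-- x ≤P y : ∀ z, (z < x → z < y) and (y < z → x < z)
module _ {a ℓ r : Level} (S : Setoid a ℓ) (_<_ : Rel (Setoid.Carrier S) r) where
  open Setoid S

  _≤P_ : Rel Carrier (a ⊔ r)
  x ≤P y = ∀ z → (z < x → z < y) × (y < z → x < z)

  record IsGenOrd : Set (a ⊔ ℓ ⊔ r) where
    field
      <-resp-≈   : _<_ Respects₂ _≈_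
      asym       : ∀ {x y} → x < y → ¬ (y < x)
      trans      : ∀ {x y z} → x < y → y < z → x < z
      pos-antisym : ∀ {x y} → x ≤P y → y ≤P x → x ≈ y

record GenOrdSet (a ℓ r : Level) : Set (suc (a ⊔ ℓ ⊔ r)) where
  field
    setoid : Setoid a ℓ
    _<_    : Rel (Setoid.Carrier setoid) r
    isGenOrd : IsGenOrd setoid _<_

module _ {a₁ ℓ₁ r₁ a₂ ℓ₂ r₂ : Level} (X : GenOrdSet a₁ ℓ₁ r₁) (Y : GenOrdSet a₂ ℓ₂ r₂) where
  private
    module X = GenOrdSet X
    module Y = GenOrdSet Y

  prodSetoid : Setoid _ _
  prodSetoid = ×-setoid X.setoid Y.setoid

  _<lex_ : Rel (Setoid.Carrier prodSetoid) (ℓ₁ ⊔ r₁ ⊔ r₂)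
  (x , y) <lex (x' , y') = X._<_ x x' ⊎ (Setoid._≈_ X.setoid x x' × Y._<_ y y')

-- If (x , y) ≤P (x' , y') lexicographically then x ≤P x': whenever the
-- witnessing comparison degenerates to the second component, it produces
-- (x' , y') < (x , y), which is impossible below something it is ≤P to.
-- In particular the first components are mutually ≤P, hence incomparable,
-- so every lexicographic comparison with a common first component is decided
-- by the second component, which transfers ≤P to the second components.
module Submission where

open import Defs
open import Level using (Level)
open import Data.Product using (_,_; proj₁; proj₂)
open import Data.Sum using (inj₁; inj₂)
open import Data.Empty using (⊥-elim)
open import Relation.Nullary using (¬_)
open import Relation.Binary.Core using (Rel)
open import Relation.Binary.Bundles using (Setoid)
open import Relation.Binary.Definitions using (Asymmetric; Transitive)

module _ {a ℓ r : Level} (S : Setoid a ℓ) (_<_ : Rel (Setoid.Carrier S) r) where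

  ≤P⇒≯ : Asymmetric _<_ → ∀ {x y} → _≤P_ S _<_ x y → ¬ (y < x)
  ≤P⇒≯ asym {x} {y} x≤y y<x = asym y<y y<y
    where
    y<y : y < y
    y<y = proj₁ (x≤y y) y<x

module Lex {a₁ ℓ₁ r₁ a₂ ℓ₂ r₂ : Level}
           (X : GenOrdSet a₁ ℓ₁ r₁) (Y : GenOrdSet a₂ ℓ₂ r₂) where

  private
    module X where
      open GenOrdSet X public
      open Setoid setoid public using (_≈_) renaming (refl to ≈-refl; sym to ≈-sym; trans to ≈-trans)
      open IsGenOrd isGenOrd public
      _≤_ : Rel (Setoid.Carrier setoid) _
      _≤_ = _≤P_ setoid _<_
      irrefl : ∀ {x} → ¬ x < x
      irrefl x<x = asym x<x x<x
      ≤⇒≯ : ∀ {x y} → x ≤ y → ¬ y < x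
      ≤⇒≯ = ≤P⇒≯ setoid _<_ asym
    module Y where
      open GenOrdSet Y public
      open IsGenOrd isGenOrd public
      _≤_ : Rel (Setoid.Carrier setoid) _
      _≤_ = _≤P_ setoid _<_

  open Setoid (prodSetoid X Y) using (_≈_; Carrier)

  _<_ : Rel Carrier _
  _<_ = _<lex_ X Y

  _≤_ : Rel Carrier _
  _≤_ = _≤P_ (prodSetoid X Y) _<_

  <-respʳ-≈ : ∀ {p q r} → q ≈ r → p < q → p < r
  <-respʳ-≈ (x≈ , y≈) (inj₁ x<) = inj₁ (proj₁ X.<-resp-≈ x≈ x<)
  <-respʳ-≈ (x≈ , y≈) (inj₂ (x≈′ , y<)) = inj₂ (X.≈-trans x≈′ x≈ , proj₁ Y.<-resp-≈ y≈ y<)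

  <-respˡ-≈ : ∀ {p q r} → q ≈ r → q < p → r < p
  <-respˡ-≈ (x≈ , y≈) (inj₁ x<) = inj₁ (proj₂ X.<-resp-≈ x≈ x<)
  <-respˡ-≈ (x≈ , y≈) (inj₂ (x≈′ , y<)) = inj₂ (X.≈-trans (X.≈-sym x≈) x≈′ , proj₂ Y.<-resp-≈ y≈ y<)

  <-asym : Asymmetric _<_
  <-asym (inj₁ x<x′) (inj₁ x′<x) = X.asym x<x′ x′<x
  <-asym (inj₁ x<x′) (inj₂ (x′≈x , _)) = X.irrefl (proj₁ X.<-resp-≈ x′≈x x<x′)
  <-asym (inj₂ (x≈x′ , _)) (inj₁ x′<x) = X.irrefl (proj₁ X.<-resp-≈ x≈x′ x′<x)
  <-asym (inj₂ (_ , y<y′)) (inj₂ (_ , y′<y)) = Y.asym y<y′ y′<y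

  <-trans : Transitive _<_
  <-trans (inj₁ x<x′) (inj₁ x′<x″) = inj₁ (X.trans x<x′ x′<x″)
  <-trans (inj₁ x<x′) (inj₂ (x′≈x″ , _)) = inj₁ (proj₁ X.<-resp-≈ x′≈x″ x<x′)
  <-trans (inj₂ (x≈x′ , _)) (inj₁ x′<x″) = inj₁ (proj₂ X.<-resp-≈ (X.≈-sym x≈x′) x′<x″)
  <-trans (inj₂ (x≈x′ , y<y′)) (inj₂ (x′≈x″ , y′<y″)) = inj₂ (X.≈-trans x≈x′ x′≈x″ , Y.trans y<y′ y′<y″)

  ≤⇒≤₁ : ∀ {x x′ y y′} → (x , y) ≤ (x′ , y′) → x X.≤ x′
  ≤⇒≤₁ {x} {x′} {y} {y′} p≤q z = below , above
    where
    q≮p : ¬ (x′ , y′) < (x , y)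
    q≮p = ≤P⇒≯ (prodSetoid X Y) _<_ <-asym p≤q

    below : z X.< x → z X.< x′
    below z<x with proj₁ (p≤q (z , y)) (inj₁ z<x)
    ... | inj₁ z<x′ = z<x′
    ... | inj₂ (z≈x′ , _) = ⊥-elim (q≮p (inj₁ (proj₂ X.<-resp-≈ z≈x′ z<x)))

    above : x′ X.< z → x X.< z
    above x′<z with proj₂ (p≤q (z , y′)) (inj₁ x′<z)
    ... | inj₁ x<z = x<z
    ... | inj₂ (x≈z , _) = ⊥-elim (q≮p (inj₁ (proj₁ X.<-resp-≈ (X.≈-sym x≈z) x′<z)))

  ≤⇒≤₂ : ∀ {x x′ y y′} → ¬ x X.< x′ → (x , y) ≤ (x′ , y′) → y Y.≤ y′
  ≤⇒≤₂ {x} {x′} {y} {y′} x≮x′ p≤q z = below , above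
    where
    below : z Y.< y → z Y.< y′
    below z<y with proj₁ (p≤q (x , z)) (inj₂ (X.≈-refl , z<y))
    ... | inj₁ x<x′ = ⊥-elim (x≮x′ x<x′)
    ... | inj₂ (_ , z<y′) = z<y′

    above : y′ Y.< z → y Y.< z
    above y′<z with proj₂ (p≤q (x′ , z)) (inj₂ (X.≈-refl , y′<z))
    ... | inj₁ x<x′ = ⊥-elim (x≮x′ x<x′)
    ... | inj₂ (_ , y<z) = y<z

  ≤-antisym : ∀ {p q} → p ≤ q → q ≤ p → p ≈ q
  ≤-antisym {x , y} {x′ , y′} p≤q q≤p =
    X.pos-antisym x≤x′ x′≤x ,
    Y.pos-antisym (≤⇒≤₂ (X.≤⇒≯ x′≤x) p≤q) (≤⇒≤₂ (X.≤⇒≯ x≤x′) q≤p)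
    where
    x≤x′ : x X.≤ x′
    x≤x′ = ≤⇒≤₁ p≤q
    x′≤x : x′ X.≤ x
    x′≤x = ≤⇒≤₁ q≤p

theorem19 : ∀ {a₁ ℓ₁ r₁ a₂ ℓ₂ r₂} (X : GenOrdSet a₁ ℓ₁ r₁) (Y : GenOrdSet a₂ ℓ₂ r₂) →
    IsGenOrd (prodSetoid X Y) (_<lex_ X Y)
theorem19 X Y = record
  { <-resp-≈    = <-respʳ-≈ , <-respˡ-≈
  ; asym        = <-asym
  ; trans       = <-trans
  ; pos-antisym = ≤-antisym
  }
  where open Lex X Y
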